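{- Assume goals $G_0$ and $G_1$ and a pair of substitutions $(\theta,\rho)$ such that $G_0\Rightarrow_{C_1,\sigma_1}G_1$ is an $SLD(\mathcal{D})$ resolution step and $(\theta,\rho)$ is a solution of $G_1$. Then $(\theta,\rho)$ is a solution of $G_0$.
   Context: $\mathcal{D}=\langle D,\sqsubseteq,\bot,\top,\circ\rangle$ is a qualification domain (lattice with extreme points and attenuation operation $\circ$); $\mathrm{glb}\,S$ is the greatest lower bound of a finite $S\subseteq D$. $\mathcal{P}$ is a fixed $QLP(\mathcal{D})$ program of clauses $H\xleftarrow{d}B_1,\dots,B_k$, $d\in D\setminus\{\bot\}$; $\mathcal{P}\vdash_{QHL(\mathcal{D})} A\sharp d$ means derivable by repeatedly applying: from $B_1\theta\sharp d_1,\dots,B_k\theta\sharp d_k$ infer $H\theta\sharp d'$ for a clause of $\mathcal{P}$, substitution $\theta$, and $d'\sqsubseteq d\circ\mathrm{glb}\{d_1,\dots,d_k\}$. A goal is $\overline{A}\mid\sigma\mid\Delta$ with $\overline{A}$ annotated atoms $A\sharp W$, $\sigma$ an idempotent substitution with $\mathrm{dom}(\sigma)\cap\mathrm{var}(\overline{A})=\emptyset$, and $\Delta$ an admissible set of threshold constraints $\alpha\circ W\sqsupseteq\beta$ (exactly one per qualification variable of $\overline{A}$) and defining constraints $W=d\circ\mathrm{glb}\{W_1,\dots,W_k\}$. A resolution step rewrites $\overline{L},A\sharp W,\overline{R}\mid\sigma_0\mid\alpha\circ W\sqsupseteq\beta,\Delta$ into $(\overline{L},B_1\sharp W_1,\dots,B_k\sharp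 W_k,\overline{R})\sigma_1\mid\sigma_0\sigma_1\mid d\circ\alpha\circ W_1\sqsupseteq\beta,\dots,d\circ\alpha\circ W_k\sqsupseteq\beta,W=d\circ\mathrm{glb}\{W_1,\dots,W_k\},\Delta$, using a variant $C_1\equiv H\xleftarrow{d}B_1,\dots,B_k$ of a program clause with fresh variables and $d\circ\alpha\sqsupseteq\beta$, $\sigma_1$ a most general unifier of $A$ and $H$, fresh qualification variables $W_i$. $(\theta,\rho)$ is a solution of $\overline{A}\mid\sigma\mid\Delta$ iff $\theta=\sigma\theta$, $\rho$ (assigning values in $D\setminus\{\bot\}$ to qualification variables) satisfies every constraint of $\Delta$, and $\mathcal{P}\vdash_{QHL(\mathcal{D})}A\theta\sharp W\rho$ for every $A\sharp W$ in $\overline{A}$. -}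

module Defs where

open import Data.Nat using (ℕ)
open import Data.List using (List; []; _∷_; _++_; map; zipWith; length; foldr)
open import Data.List.Membership.Propositional using (_∈_)
open import Data.List.Relation.Unary.Any using (Any)
open import Data.List.Relation.Unary.All using (All)
open import Data.List.Relation.Unary.Unique.Propositional using (Unique)
open import Data.List.Relation.Binary.Pointwise using (Pointwise)
open import Data.List.Relation.Binary.Permutation.Propositional using (_↭_)
open import Data.Product using (Σ; ∃; ∃-syntax; _×_; _,_)
open import Relation.Binary.PropositionalEquality using (_≡_; _≢_)
open import Relation.Binary.Lattice.Structures using (IsBoundedLattice)
open import Relation.Nullary using (¬_)
open import Function.Definitions using (Injective)

record QualDomain : Set₁ where
  infixr 7 _∘_
  infix 4 _⊑_
  field
    D      : Set
    _⊑_    : D → D → Set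
    _⊔_    : D → D → D
    _⊓_    : D → D → D
    ⊤ ⊥    : D
    isBoundedLattice : IsBoundedLattice _≡_ _⊑_ _⊔_ _⊓_ ⊤ ⊥
    _∘_    : D → D → D
    ∘-assoc : ∀ a b c → (a ∘ b) ∘ c ≡ a ∘ (b ∘ c)
    ∘-comm  : ∀ a b → a ∘ b ≡ b ∘ a
    ∘-mono  : ∀ {a a' b b'} → a ⊑ a' → b ⊑ b' → a ∘ b ⊑ a' ∘ b'
    ∘-⊤     : ∀ d → d ∘ ⊤ ≡ d
    ∘-⊥     : ∀ d → d ∘ ⊥ ≡ ⊥
    ∘-⊑     : ∀ d e → d ∘ e ⊑ e
    ∘-⊓     : ∀ d e₁ e₂ → d ∘ (e₁ ⊓ e₂) ≡ (d ∘ e₁) ⊓ (d ∘ e₂)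

  glb : List D → D
  glb = foldr _⊓_ ⊤

Var : Set
Var = ℕ

data Term : Set where
  var : Var → Term
  fun : ℕ → List Term → Term

data Atom : Set where
  atom : ℕ → List Term → Atom

-- substitutions (total maps; domain = {x | σ x ≢ var x})
Subst : Set
Subst = Var → Term

mutual
  _⟨_⟩ : Term → Subst → Term
  var x ⟨ σ ⟩ = σ x
  fun f ts ⟨ σ ⟩ = fun f (ts ⟨ σ ⟩*)

  _⟨_⟩* : List Term → Subst → List Term
  [] ⟨ σ ⟩* = []
  (t ∷ ts) ⟨ σ ⟩* = t ⟨ σ ⟩ ∷ ts ⟨ σ ⟩*

_⟨_⟩ₐ : Atom → Subst → Atom
atom p ts ⟨ σ ⟩ₐ = atom p (ts ⟨ σ ⟩*)

-- composition in logic-programming order: t(σ ⨾ τ) = (t σ) τ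
_⨾_ : Subst → Subst → Subst
(σ ⨾ τ) x = σ x ⟨ τ ⟩

_≈ₛ_ : Subst → Subst → Set
σ ≈ₛ τ = ∀ x → σ x ≡ τ x

Idempotent : Subst → Set
Idempotent σ = (σ ⨾ σ) ≈ₛ σ

data _∈ᵥ_ (x : Var) : Term → Set where
  here : x ∈ᵥ var x
  arg  : ∀ {f ts} → Any (x ∈ᵥ_) ts → x ∈ᵥ fun f ts

data _∈ᵥₐ_ (x : Var) : Atom → Set where
  arg : ∀ {p ts} → Any (x ∈ᵥ_) ts → x ∈ᵥₐ atom p ts

Unifier : Subst → Atom → Atom → Set
Unifier σ A H = A ⟨ σ ⟩ₐ ≡ H ⟨ σ ⟩ₐ

MGU : Subst → Atom → Atom → Set
MGU σ A H = Unifier σ A H × (∀ τ → Unifier τ A H → ∃[ δ ] (τ ≈ₛ (σ ⨾ δ)))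

module QLP (𝒟 : QualDomain) where
  open QualDomain 𝒟

  record Clause : Set where
    constructor _←[_]_
    field
      head : Atom
      qual : D
      body : List Atom
  open Clause public

  record Program : Set where
    field
      clauses : List Clause
      qual≢⊥  : All (λ C → qual C ≢ ⊥) clauses
  open Program public

  renameClause : (Var → Var) → Clause → Clause
  renameClause r (H ←[ d ] Bs) =
    (H ⟨ (λ x → var (r x)) ⟩ₐ) ←[ d ] map (λ B → B ⟨ (λ x → var (r x)) ⟩ₐ) Bs

  data _⊢_♯_ (P : Program) : Atom → D → Set where
    rule : ∀ {C θ ds d'} → C ∈ clauses P →
           Pointwise (λ B dᵢ → P ⊢ B ⟨ θ ⟩ₐ ♯ dᵢ) (body C) ds →
           d' ⊑ qual C ∘ glb ds →
           P ⊢ head C ⟨ θ ⟩ₐ ♯ d'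

  QVar : Set
  QVar = ℕ

  record AnnAtom : Set where
    constructor _♯_
    field
      atm  : Atom
      qvar : QVar
  open AnnAtom public

  applyAnn : Subst → AnnAtom → AnnAtom
  applyAnn σ (A ♯ W) = (A ⟨ σ ⟩ₐ) ♯ W

  data Constraint : Set where
    -- α ∘ W ⊒ β
    threshold : (α β : D) → QVar → Constraint
    -- W = d ∘ glb {W₁,…,Wₖ}
    defining  : QVar → D → List QVar → Constraint

  data _∈q_ (V : QVar) : Constraint → Set where
    thr : ∀ {α β} → V ∈q threshold α β V
    defL : ∀ {d Ws} → V ∈q defining V d Ws
    defR : ∀ {W d Ws} → V ∈ Ws → V ∈q defining W d Ws

  IsThresholdOn : QVar → Constraint → Set
  IsThresholdOn V (threshold α β W) = V ≡ W
  IsThresholdOn V (defining _ _ _) = Data.Empty.⊥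
    where import Data.Empty

  record Goal : Set where
    constructor _∣_∣_
    field
      atoms : List AnnAtom
      subst : Subst
      cstrs : List Constraint
  open Goal public

  Admissible : List AnnAtom → List Constraint → Set
  Admissible As Δ =
    (∀ V → Any (λ a → qvar a ≡ V) As →
       ∃[ c ] (c ∈ Δ × IsThresholdOn V c ×
               (∀ c' → c' ∈ Δ → IsThresholdOn V c' → c' ≡ c)))
    × (∀ V c → c ∈ Δ → IsThresholdOn V c → Any (λ a → qvar a ≡ V) As)

  IsGoal : Goal → Set
  IsGoal (As ∣ σ ∣ Δ) =
    Idempotent σ
    × (∀ x → Any (λ a → x ∈ᵥₐ atm a) As → σ x ≡ var x)
    × Admissible As Δ

  _∈ᵥᶜ_ : Var → Clause → Set
  x ∈ᵥᶜ C = x ∈ᵥₐ head C ⊎ Any (x ∈ᵥₐ_) (body C)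
    where open import Data.Sum using (_⊎_)

  FreshVar : Var → Goal → Set
  FreshVar x (As ∣ σ ∣ Δ) =
    ¬ Any (λ a → x ∈ᵥₐ atm a) As
    × σ x ≡ var x
    × (∀ y → x ∈ᵥ σ y → σ y ≡ var y)

  FreshQVar : QVar → Goal → Set
  FreshQVar V (As ∣ σ ∣ Δ) =
    ¬ Any (λ a → qvar a ≡ V) As × ¬ Any (V ∈q_) Δ

  FreshVariant : Program → Clause → Goal → Set
  FreshVariant P C₁ G =
    ∃[ C ] ∃[ r ] (C ∈ clauses P × Injective _≡_ _≡_ r × C₁ ≡ renameClause r C
                   × (∀ x → x ∈ᵥᶜ C₁ → FreshVar x G))

  Step : Program → Goal → Clause → Subst → Goal → Set
  Step P G₀ C₁ σ₁ G₁ =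
    ∃[ L ] ∃[ A ] ∃[ W ] ∃[ R ] ∃[ α ] ∃[ β ] ∃[ Δ ] ∃[ Ws ]
      ( atoms G₀ ≡ L ++ (A ♯ W) ∷ R
      × cstrs G₀ ↭ threshold α β W ∷ Δ
      × FreshVariant P C₁ G₀
      × β ⊑ qual C₁ ∘ α
      × MGU σ₁ A (head C₁)
      × length Ws ≡ length (body C₁)
      × Unique Ws
      × All (λ V → FreshQVar V G₀) Ws
      × atoms G₁ ≡ map (applyAnn σ₁) (L ++ zipWith _♯_ (body C₁) Ws ++ R)
      × subst G₁ ≈ₛ (subst G₀ ⨾ σ₁)
      × cstrs G₁ ↭ (map (threshold (qual C₁ ∘ α) β) Ws
                     ++ defining W (qual C₁) Ws ∷ Δ) )

  Sat : (QVar → D) → Constraint → Set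
  Sat ρ (threshold α β W) = β ⊑ α ∘ ρ W
  Sat ρ (defining W d Ws) = ρ W ≡ d ∘ glb (map ρ Ws)

  Solution : Program → Goal → Subst → (QVar → D) → Set
  Solution P (As ∣ σ ∣ Δ) θ ρ =
    θ ≈ₛ (σ ⨾ θ)
    × (∀ V → ρ V ≢ ⊥)
    × All (Sat ρ) Δ
    × All (λ a → P ⊢ atm a ⟨ θ ⟩ₐ ♯ ρ (qvar a)) As

-- The substitution: σ₀ is idempotent and θ factors through σ₀σ₁, so θ is a
-- fixed point of σ₀; as σ₀ is the identity on the atoms of G₀, θ agrees there
-- with σ₁θ, so the atoms of G₀ other than A are solved as in G₁.
-- The selected atom: A σ₁ θ is an instance of the clause head whose body atoms
-- are solved with the degrees ρ Wᵢ, so one QHL(D) inference derives it with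
-- degree ρ W, which the defining constraint fixes as d ∘ glb {ρ Wᵢ}.
-- The threshold α ∘ W ⊒ β: the constraints d ∘ α ∘ Wᵢ ⊒ β together with
-- d ∘ α ⊒ β (needed when k = 0) give d ∘ α ∘ glb {ρ Wᵢ} ⊒ β, since attenuation
-- distributes over glb.
module Submission where

open import Defs
open import Data.Nat.Properties using (suc-injective)
open import Data.List using (List; []; _∷_; _++_; map; zipWith; length)
open import Data.List.Relation.Unary.Any using (Any; here; there)
open import Data.List.Membership.Propositional using (_∈_)
open import Data.List.Relation.Unary.All as All using (All; []; _∷_)
import Data.List.Relation.Unary.All.Properties as Allₚ
open import Data.List.Relation.Binary.Pointwise using (Pointwise; []; _∷_)
open import Data.List.Relation.Binary.Permutation.Propositional using (↭-sym)
open import Data.List.Relation.Binary.Permutation.Propositional.Properties using (All-resp-↭)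
open import Data.Product using (_,_)
open import Relation.Binary.Lattice.Structures using (IsBoundedLattice)
open import Relation.Binary.PropositionalEquality
open ≡-Reasoning

mutual
  ⟨⟩-⨾ : ∀ t σ τ → t ⟨ σ ⟩ ⟨ τ ⟩ ≡ t ⟨ σ ⨾ τ ⟩
  ⟨⟩-⨾ (var x)    σ τ = refl
  ⟨⟩-⨾ (fun f ts) σ τ = cong (fun f) (⟨⟩*-⨾ ts σ τ)

  ⟨⟩*-⨾ : ∀ ts σ τ → ts ⟨ σ ⟩* ⟨ τ ⟩* ≡ ts ⟨ σ ⨾ τ ⟩*
  ⟨⟩*-⨾ []       σ τ = refl
  ⟨⟩*-⨾ (t ∷ ts) σ τ = cong₂ _∷_ (⟨⟩-⨾ t σ τ) (⟨⟩*-⨾ ts σ τ)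

⟨⟩ₐ-⨾ : ∀ A σ τ → A ⟨ σ ⟩ₐ ⟨ τ ⟩ₐ ≡ A ⟨ σ ⨾ τ ⟩ₐ
⟨⟩ₐ-⨾ (atom p ts) σ τ = cong (atom p) (⟨⟩*-⨾ ts σ τ)

⨾-assoc : ∀ σ τ υ → ((σ ⨾ τ) ⨾ υ) ≈ₛ (σ ⨾ (τ ⨾ υ))
⨾-assoc σ τ υ x = ⟨⟩-⨾ (σ x) τ υ

mutual
  ⟨⟩-cong : ∀ t {σ τ} → (∀ x → x ∈ᵥ t → σ x ≡ τ x) → t ⟨ σ ⟩ ≡ t ⟨ τ ⟩
  ⟨⟩-cong (var x)    σ≈τ = σ≈τ x here
  ⟨⟩-cong (fun f ts) σ≈τ = cong (fun f) (⟨⟩*-cong ts (λ x x∈ → σ≈τ x (arg x∈)))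

  ⟨⟩*-cong : ∀ ts {σ τ} → (∀ x → Any (x ∈ᵥ_) ts → σ x ≡ τ x) → ts ⟨ σ ⟩* ≡ ts ⟨ τ ⟩*
  ⟨⟩*-cong []       σ≈τ = refl
  ⟨⟩*-cong (t ∷ ts) σ≈τ =
    cong₂ _∷_ (⟨⟩-cong t (λ x x∈ → σ≈τ x (here x∈))) (⟨⟩*-cong ts (λ x x∈ → σ≈τ x (there x∈)))

⟨⟩ₐ-cong : ∀ A {σ τ} → (∀ x → x ∈ᵥₐ A → σ x ≡ τ x) → A ⟨ σ ⟩ₐ ≡ A ⟨ τ ⟩ₐ
⟨⟩ₐ-cong (atom p ts) σ≈τ = cong (atom p) (⟨⟩*-cong ts (λ x x∈ → σ≈τ x (arg x∈)))

⨾-congʳ : ∀ σ {τ υ} → τ ≈ₛ υ → (σ ⨾ τ) ≈ₛ (σ ⨾ υ)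
⨾-congʳ σ τ≈υ x = ⟨⟩-cong (σ x) (λ y _ → τ≈υ y)

idempotent⇒fixes : ∀ {σ θ} τ → Idempotent σ → θ ≈ₛ (σ ⨾ τ) → θ ≈ₛ (σ ⨾ θ)
idempotent⇒fixes {σ} {θ} τ σσ≈σ θ≈στ x = begin
  θ x                ≡⟨ θ≈στ x ⟩
  σ x ⟨ τ ⟩          ≡⟨ cong (_⟨ τ ⟩) (sym (σσ≈σ x)) ⟩
  (σ ⨾ σ) x ⟨ τ ⟩    ≡⟨ ⨾-assoc σ σ τ x ⟩
  σ x ⟨ σ ⨾ τ ⟩      ≡⟨ sym (⨾-congʳ σ θ≈στ x) ⟩
  σ x ⟨ θ ⟩          ∎

rename : (Var → Var) → Subst
rename r x = var (r x)

unifier-instance : ∀ {σ A H} π θ → Unifier σ A (H ⟨ π ⟩ₐ) → A ⟨ σ ⨾ θ ⟩ₐ ≡ H ⟨ π ⨾ (σ ⨾ θ) ⟩ₐ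
unifier-instance {σ} {A} {H} π θ unifies = begin
  A ⟨ σ ⨾ θ ⟩ₐ              ≡⟨ sym (⟨⟩ₐ-⨾ A σ θ) ⟩
  A ⟨ σ ⟩ₐ ⟨ θ ⟩ₐ           ≡⟨ cong (_⟨ θ ⟩ₐ) unifies ⟩
  H ⟨ π ⟩ₐ ⟨ σ ⟩ₐ ⟨ θ ⟩ₐ    ≡⟨ ⟨⟩ₐ-⨾ (H ⟨ π ⟩ₐ) σ θ ⟩
  H ⟨ π ⟩ₐ ⟨ σ ⨾ θ ⟩ₐ       ≡⟨ ⟨⟩ₐ-⨾ H π (σ ⨾ θ) ⟩
  H ⟨ π ⨾ (σ ⨾ θ) ⟩ₐ        ∎

All-++-replace : ∀ {A : Set} {Q : A → Set} L Z {R a} → Q a → All Q (L ++ Z ++ R) → All Q (L ++ a ∷ R)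
All-++-replace L Z q all = Allₚ.++⁺ (Allₚ.++⁻ˡ L all) (q ∷ Allₚ.++⁻ʳ Z (Allₚ.++⁻ʳ L all))

module Attenuation (𝒟 : QualDomain) where
  open QualDomain 𝒟
  open IsBoundedLattice isBoundedLattice using (∧-greatest)

  ⊑-∘-glb : ∀ {β c} ds → β ⊑ c → All (λ e → β ⊑ c ∘ e) ds → β ⊑ c ∘ glb ds
  ⊑-∘-glb {β} {c} []       β⊑c []         = subst (β ⊑_) (sym (∘-⊤ c)) β⊑c
  ⊑-∘-glb {β} {c} (e ∷ ds) β⊑c (β⊑ce ∷ β⊑cds) =
    subst (β ⊑_) (sym (∘-⊓ c e (glb ds))) (∧-greatest β⊑ce (⊑-∘-glb ds β⊑c β⊑cds))

  ∘-rotate : ∀ d α e → (d ∘ α) ∘ e ≡ α ∘ (d ∘ e)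
  ∘-rotate d α e = begin
    (d ∘ α) ∘ e   ≡⟨ ∘-assoc d α e ⟩
    d ∘ (α ∘ e)   ≡⟨ cong (d ∘_) (∘-comm α e) ⟩
    d ∘ (e ∘ α)   ≡⟨ sym (∘-assoc d e α) ⟩
    (d ∘ e) ∘ α   ≡⟨ ∘-comm (d ∘ e) α ⟩
    α ∘ (d ∘ e)   ∎

  threshold-resolved : ∀ {I : Set} {ρ : I → D} {α β d W} (Ws : List I) → β ⊑ d ∘ α →
    All (λ V → β ⊑ (d ∘ α) ∘ ρ V) Ws → ρ W ≡ d ∘ glb (map ρ Ws) → β ⊑ α ∘ ρ W
  threshold-resolved {ρ = ρ} {α} {β} {d} Ws β⊑dα β⊑dαρWs ρW≡ =
    subst (λ e → β ⊑ α ∘ e) (sym ρW≡)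
      (subst (β ⊑_) (∘-rotate d α (glb (map ρ Ws)))
        (⊑-∘-glb (map ρ Ws) β⊑dα (Allₚ.map⁺ β⊑dαρWs)))

module SolutionTransfer (𝒟 : QualDomain) (P : QLP.Program 𝒟) where
  open QualDomain 𝒟
  open IsBoundedLattice isBoundedLattice using (reflexive)
  open QLP 𝒟 hiding (subst)
  open Attenuation 𝒟

  sat-resolvent : ∀ {ρ α β d W Ws Δ} → β ⊑ d ∘ α →
    All (Sat ρ) (map (threshold (d ∘ α) β) Ws ++ defining W d Ws ∷ Δ) →
    All (Sat ρ) (threshold α β W ∷ Δ)
  sat-resolvent {α = α} {β} {d} {Ws = Ws} β⊑dα sat =
    threshold-resolved Ws β⊑dα (Allₚ.map⁻ (Allₚ.++⁻ˡ thresholds sat)) (All.head rest)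
    ∷ All.tail rest
    where
    thresholds = map (threshold (d ∘ α) β) Ws
    rest = Allₚ.++⁻ʳ thresholds sat

  Solves : Subst → (QVar → D) → AnnAtom → Set
  Solves θ ρ a = P ⊢ atm a ⟨ θ ⟩ₐ ♯ ρ (qvar a)

  solves-applyAnn : ∀ {σ θ ρ} as →
    All (Solves θ ρ) (map (applyAnn σ) as) → All (Solves (σ ⨾ θ) ρ) as
  solves-applyAnn {σ} {θ} {ρ} as solved =
    All.map (λ {a} → subst (λ B → P ⊢ B ♯ ρ (qvar a)) (⟨⟩ₐ-⨾ (atm a) σ θ)) (Allₚ.map⁻ solved)

  solves-cong : ∀ {σ τ ρ} as → (∀ x → Any (λ a → x ∈ᵥₐ atm a) as → σ x ≡ τ x) →
    All (Solves σ ρ) as → All (Solves τ ρ) as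
  solves-cong []       σ≈τ []       = []
  solves-cong {ρ = ρ} (a ∷ as) σ≈τ (s ∷ ss) =
    subst (λ B → P ⊢ B ♯ ρ (qvar a)) (⟨⟩ₐ-cong (atm a) (λ x x∈ → σ≈τ x (here x∈))) s
    ∷ solves-cong as (λ x x∈ → σ≈τ x (there x∈)) ss

  solves-renamed-body : ∀ {τ ρ} r Bs Ws → length Ws ≡ length (map (_⟨ rename r ⟩ₐ) Bs) →
    All (Solves τ ρ) (zipWith _♯_ (map (_⟨ rename r ⟩ₐ) Bs) Ws) →
    Pointwise (λ B d → P ⊢ B ⟨ rename r ⨾ τ ⟩ₐ ♯ d) Bs (map ρ Ws)
  solves-renamed-body r []       []       _   []       = []
  solves-renamed-body {τ} {ρ} r (B ∷ Bs) (W ∷ Ws) |≡| (s ∷ ss) =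
    subst (λ B' → P ⊢ B' ♯ ρ W) (⟨⟩ₐ-⨾ B (rename r) τ) s
    ∷ solves-renamed-body r Bs Ws (suc-injective |≡|) ss

  solves-head : ∀ {C τ ρ W} r Ws → C ∈ clauses P →
    length Ws ≡ length (map (_⟨ rename r ⟩ₐ) (body C)) → ρ W ≡ qual C ∘ glb (map ρ Ws) →
    All (Solves τ ρ) (zipWith _♯_ (map (_⟨ rename r ⟩ₐ) (body C)) Ws) →
    P ⊢ head C ⟨ rename r ⨾ τ ⟩ₐ ♯ ρ W
  solves-head {C} r Ws C∈P |≡| ρW≡ solved =
    rule C∈P (solves-renamed-body r (body C) Ws |≡| solved) (reflexive ρW≡)

lemma1 : (𝒟 : QualDomain) → let open QLP 𝒟 in
    ∀ (P : Program) (G₀ G₁ : Goal) (C₁ : Clause) (σ₁ θ : Subst) (ρ : QVar → QualDomain.D 𝒟) →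
    IsGoal G₀ → IsGoal G₁ →
    Step P G₀ C₁ σ₁ G₁ →
    Solution P G₁ θ ρ →
    Solution P G₀ θ ρ
lemma1 𝒟 P G₀ G₁ C₁ σ₁ θ ρ (σ₀-idem , σ₀-off-atoms , _) _
  (L , A , W , R , α , β , Δ , Ws , refl , Δ₀↭ , (C , r , C∈P , _ , refl , _) , β⊑dα
     , (unifies , _) , |Ws| , _ , _ , refl , σ₁'≈ , Δ₁↭)
  (θ≈ , ρ≢⊥ , sat₁ , solved₁) =
    idempotent⇒fixes τ σ₀-idem θ≈σ₀τ
  , ρ≢⊥
  , All-resp-↭ (↭-sym Δ₀↭) (sat-resolvent β⊑dα sat₁-ordered)
  , solves-cong (L ++ A ♯ W ∷ R) τ≈θ-on-atoms (All-++-replace L Z selected-solved solved-τ)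
  where
  open QualDomain 𝒟
  open QLP 𝒟 hiding (subst)
  open SolutionTransfer 𝒟 P
  τ = σ₁ ⨾ θ
  Z = zipWith _♯_ (body C₁) Ws
  σ₀ = Goal.subst G₀
  θ≈σ₀τ : θ ≈ₛ (σ₀ ⨾ τ)
  θ≈σ₀τ x = trans (θ≈ x) (trans (cong (_⟨ θ ⟩) (σ₁'≈ x)) (⨾-assoc σ₀ σ₁ θ x))
  τ≈θ-on-atoms : ∀ x → Any (λ a → x ∈ᵥₐ atm a) (L ++ A ♯ W ∷ R) → τ x ≡ θ x
  τ≈θ-on-atoms x x∈ = trans (cong (_⟨ τ ⟩) (sym (σ₀-off-atoms x x∈))) (sym (θ≈σ₀τ x))
  sat₁-ordered = All-resp-↭ Δ₁↭ sat₁
  ρW≡ : ρ W ≡ qual C ∘ glb (map ρ Ws)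
  ρW≡ = All.head (Allₚ.++⁻ʳ (map (threshold (qual C ∘ α) β) Ws) sat₁-ordered)
  solved-τ : All (Solves τ ρ) (L ++ Z ++ R)
  solved-τ = solves-applyAnn (L ++ Z ++ R) solved₁
  selected-solved : P ⊢ A ⟨ τ ⟩ₐ ♯ ρ W
  selected-solved = subst (λ B → P ⊢ B ♯ ρ W) (sym (unifier-instance (rename r) θ unifies))
    (solves-head r Ws C∈P |Ws| ρW≡ (Allₚ.++⁻ˡ Z (Allₚ.++⁻ʳ L solved-τ)))
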